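{- Let $N$ be a positive odd integer, $r\ge s\ge 2$, and $\Phi_r^s=\Gamma_1(2^sN)\cap\Gamma_0(2^r)$. The transfer morphism $V:\Phi_r^{s\,\mathrm{ab}}\to\Gamma_1(2^rN)^{\mathrm{ab}}$ associated to the finite-index inclusion $\Gamma_1(2^rN)\subseteq\Phi_r^s$ commutes with the action of the Atkin operator $U$ on its source and target.
   Context: $\Gamma_1(M)$: matrices in $\mathrm{SL}_2(\mathbb{Z})$ congruent to $\begin{pmatrix}1&*\\0&1\end{pmatrix}$ mod $M$; $\Gamma_0(M)$: lower-left entry divisible by $M$; $\Gamma^0(2)$: matrices in $\mathrm{SL}_2(\mathbb{Z})$ with even upper-right entry; $t=\begin{pmatrix}1&0\\0&2\end{pmatrix}$. For $r\ge s\ge2$ the Atkin operator $U$ on $\Phi_r^{s\,\mathrm{ab}}$ is the composition of the transfer $\Phi_r^{s\,\mathrm{ab}}\to(\Phi_r^s\cap\Gamma^0(2))^{\mathrm{ab}}$, the isomorphism onto $\Phi_{r+1}^{s\,\mathrm{ab}}$ induced by $g\mapsto tgt^{ -1}$, and the map $\Phi_{r+1}^{s\,\mathrm{ab}}\to\Phi_r^{s\,\mathrm{ab}}$ induced by inclusion; note $\Phi_r^r=\Gamma_1(2^rN)$, so this also defines $U$ on $\Gamma_1(2^rN)^{\mathrm{ab}}$. -}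

module Defs where

open import Data.Nat using (ℕ; zero; suc; _^_) renaming (_*_ to _*ℕ_)
open import Data.Integer using (ℤ; +_; _+_; _-_; _*_; -_)
open import Data.Integer.Divisibility using (_∣_)
open import Data.Integer.DivMod using (_/ℕ_)
open import Data.Fin using (Fin; zero; suc)
open import Data.Product using (_×_)
open import Relation.Binary.PropositionalEquality using (_≡_)

record M2 : Set where
  constructor mat
  field
    a b c d : ℤ
open M2 public

infixl 7 _·_
_·_ : M2 → M2 → M2
mat a₁ b₁ c₁ d₁ · mat a₂ b₂ c₂ d₂ =
  mat (a₁ * a₂ + b₁ * c₂) (a₁ * b₂ + b₁ * d₂) (c₁ * a₂ + d₁ * c₂) (c₁ * b₂ + d₁ * d₂)

I₂ : M2
I₂ = mat (+ 1) (+ 0) (+ 0) (+ 1)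

-- inverse of a determinant-one matrix (adjugate)
inv : M2 → M2
inv (mat a b c d) = mat d (- b) (- c) a

SL2 : M2 → Set
SL2 g = a g * d g - b g * c g ≡ + 1

Γ₁ : ℕ → M2 → Set
Γ₁ m g = SL2 g × (+ m ∣ (a g - + 1)) × (+ m ∣ c g) × (+ m ∣ (d g - + 1))

Γ₀ : ℕ → M2 → Set
Γ₀ m g = SL2 g × (+ m ∣ c g)

Γ⁰2 : M2 → Set
Γ⁰2 g = SL2 g × (+ 2 ∣ b g)

_∩_ : (M2 → Set) → (M2 → Set) → M2 → Set
(P ∩ Q) g = P g × Q g

Φ : ℕ → ℕ → ℕ → M2 → Set
Φ N r s = Γ₁ (2 ^ s *ℕ N) ∩ Γ₀ (2 ^ r)

-- conjugation g ↦ t g t⁻¹ with t = diag(1,2): (a b ; c d) ↦ (a b/2 ; 2c d)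
-- (applied only to matrices with even b, where b/2 is exact)
conj-t : M2 → M2
conj-t (mat a b c d) = mat a (b /ℕ 2) (+ 2 * c) d

data Comm (H : M2 → Set) : M2 → Set where
  comm-id  : Comm H I₂
  comm-gen : ∀ {x y} → H x → H y → Comm H (x · y · inv x · inv y)
  comm-mul : ∀ {g h} → Comm H g → Comm H h → Comm H (g · h)

-- equality in the abelianisation H^ab : g ~ h  iff  g h⁻¹ ∈ [H,H]
AbEq : (H : M2 → Set) → M2 → M2 → Set
AbEq H g h = Comm H (g · inv h)

-- product over Fin n (order is immaterial in the abelianisation)
prodF : (n : ℕ) → (Fin n → M2) → M2
prodF zero    f = I₂
prodF (suc n) f = f zero · prodF n (λ i → f (suc i))

record Transversal (G H : M2 → Set) : Set where
  field
    n        : ℕ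
    rep      : Fin n → M2
    rep∈     : ∀ i → G (rep i)
    idx      : M2 → Fin n
    idx-spec : ∀ g → G g → H (inv (rep (idx g)) · g)
    idx-uniq : ∀ g i → G g → H (inv (rep i) · g) → idx g ≡ i
open Transversal public

-- transfer G^ab → H^ab on representatives:
-- V(g) = ∏_i h_i  where  g x_i = x_{σ(i)} h_i
transfer : ∀ {G H} → Transversal G H → M2 → M2
transfer T g = prodF (n T) (λ i → inv (rep T (idx T (g · rep T i))) · g · rep T i)

-- Atkin operator on G^ab (G = Φ_r^s, in particular Γ₁(2^r N) = Φ_r^r):
-- transfer to (G ∩ Γ⁰(2))^ab, conjugate by t, then include back into G
atkinU : ∀ {G} → Transversal G (G ∩ Γ⁰2) → M2 → M2
atkinU T g = conj-t (transfer T g)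

-- Write A = Φ ∩ Γ⁰(2), B = Γ₁(2^r N) ∩ Γ⁰(2) and φ(g) = t g t⁻¹, so that U is transfer to A
-- (resp. B) followed by φ. By transitivity of the transfer and its independence of the chosen
-- transversal, the transfers Φ → A → B and Φ → Γ₁(2^r N) → B agree in B^ab; φ carries this to
-- Γ₁(2^r N)^ab. It remains to commute φ with V. For that pick representatives of Γ₁(2^r N) in Φ
-- of the form φ(zᵢ) with zᵢ ∈ A: since φ⁻¹(Γ₁(2^r N)) ∩ A = B (N is odd), the zᵢ form a
-- transversal of B in A, and the transfer along it is carried by φ to V ∘ φ. Such representatives
-- exist: replacing xᵢ by xᵢ (1 0; N cᵢ 1), in the same coset, makes the lower-left entry
-- cᵢ (1 + N dᵢ) even.

module Submission where

open import Defs
open import Data.Nat using (ℕ; _≤_; _^_; _*_; NonZero)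
open import Data.Nat.Divisibility using (_∣_)
open import Relation.Nullary using (¬_)
open import Algebra.Bundles using (Monoid; CommutativeMonoid)
import Algebra.Properties.Monoid.Sum as MonoidSum
import Algebra.Properties.CommutativeMonoid.Sum as CommutativeMonoidSum
import Algebra.Solver.Monoid as MonoidSolver
import Algebra.Solver.CommutativeMonoid as CommutativeMonoidSolver
open import Data.Empty using (⊥-elim)
open import Data.Fin using (Fin; zero; suc; _↑ˡ_; _↑ʳ_; combine; remQuot)
open import Data.Fin.Permutation using (Permutation; permutation; _⟨$⟩ʳ_)
open import Data.Fin.Properties using (remQuot-combine; combine-remQuot)
open import Data.Integer using (ℤ; +_; -_; -[1+_]; _/ℕ_; ∣_∣) renaming (_+_ to _+ℤ_; _*_ to _*ℤ_; _-_ to _-ℤ_)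
import Data.Integer.Properties as ℤ
open import Data.Integer.Divisibility using () renaming (_∣_ to _∣ℤ_)
import Data.Integer.Divisibility.Signed as Signed
open import Data.Integer.Tactic.RingSolver using (solve-∀)
open import Data.Nat using (zero; suc; _+_; _∸_; _%_; _/_; s≤s; z≤n)
open import Data.Nat.Properties using (≤-trans; ^-distribˡ-+-*; m+[n∸m]≡n; *-comm; m^n≢0)
open import Data.Nat.DivMod using (m≡m%n+[m/n]*n; m%n<n; m*n/n≡m; m*n%n≡0)
open import Data.Nat.Divisibility
  using (divides; _∣0; ∣-refl; ∣-trans; ∣m+n∣m⇒∣n; ∣n⇒∣m*n; m∣m*n; *-monoʳ-∣; *-monoˡ-∣; *-cancelˡ-∣; m%n≡0⇒n∣m)
import Data.Nat.Tactic.RingSolver as ℕ-Tactic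
open import Data.Product using (Σ; _,_; _×_; proj₁; proj₂)
open import Relation.Binary.PropositionalEquality
  using (_≡_; refl; sym; trans; cong; cong₂; subst; subst₂; isEquivalence; module ≡-Reasoning)
import Relation.Binary.Reasoning.Setoid as SetoidReasoning

-- 2×2 integer matrices

mat-cong : ∀ {a b c d a' b' c' d'} → a ≡ a' → b ≡ b' → c ≡ c' → d ≡ d' →
           mat a b c d ≡ mat a' b' c' d'
mat-cong refl refl refl refl = refl

·-assoc : ∀ x y z → (x · y) · z ≡ x · (y · z)
·-assoc (mat a b c d) (mat e f g h) (mat i j k l) =
  mat-cong (left a b e f g h i k) (right a b e f g h j l)
           (left c d e f g h i k) (right c d e f g h j l)
  where
  left : ∀ a b e f g h i k → (a *ℤ e +ℤ b *ℤ g) *ℤ i +ℤ (a *ℤ f +ℤ b *ℤ h) *ℤ k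
               ≡ a *ℤ (e *ℤ i +ℤ f *ℤ k) +ℤ b *ℤ (g *ℤ i +ℤ h *ℤ k)
  left = solve-∀
  right : ∀ a b e f g h j l → (a *ℤ e +ℤ b *ℤ g) *ℤ j +ℤ (a *ℤ f +ℤ b *ℤ h) *ℤ l
                ≡ a *ℤ (e *ℤ j +ℤ f *ℤ l) +ℤ b *ℤ (g *ℤ j +ℤ h *ℤ l)
  right = solve-∀

·-identityˡ : ∀ x → I₂ · x ≡ x
·-identityˡ (mat a b c d) = mat-cong (unit a c) (unit b d) (unit′ a c) (unit′ b d)
  where
  unit : ∀ a c → + 1 *ℤ a +ℤ + 0 *ℤ c ≡ a
  unit = solve-∀
  unit′ : ∀ a c → + 0 *ℤ a +ℤ + 1 *ℤ c ≡ c
  unit′ = solve-∀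

·-identityʳ : ∀ x → x · I₂ ≡ x
·-identityʳ (mat a b c d) = mat-cong (unit a b) (unit′ a b) (unit c d) (unit′ c d)
  where
  unit : ∀ a b → a *ℤ + 1 +ℤ b *ℤ + 0 ≡ a
  unit = solve-∀
  unit′ : ∀ a b → a *ℤ + 0 +ℤ b *ℤ + 1 ≡ b
  unit′ = solve-∀

inv-anti-homo-· : ∀ x y → inv (x · y) ≡ inv y · inv x
inv-anti-homo-· (mat a b c d) (mat e f g h) =
  mat-cong (a′ c d f h) (b′ a b f h) (c′ c d e g) (d′ a b e g)
  where
  a′ : ∀ c d f h → c *ℤ f +ℤ d *ℤ h ≡ h *ℤ d +ℤ (- f) *ℤ (- c)
  a′ = solve-∀
  b′ : ∀ a b f h → - (a *ℤ f +ℤ b *ℤ h) ≡ h *ℤ (- b) +ℤ (- f) *ℤ a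
  b′ = solve-∀
  c′ : ∀ c d e g → - (c *ℤ e +ℤ d *ℤ g) ≡ (- g) *ℤ d +ℤ e *ℤ (- c)
  c′ = solve-∀
  d′ : ∀ a b e g → a *ℤ e +ℤ b *ℤ g ≡ (- g) *ℤ (- b) +ℤ e *ℤ a
  d′ = solve-∀

inv-involutive : ∀ x → inv (inv x) ≡ x
inv-involutive (mat a b c d) = mat-cong refl (ℤ.neg-involutive b) (ℤ.neg-involutive c) refl

·-inverseʳ : ∀ x → SL2 x → x · inv x ≡ I₂
·-inverseʳ (mat a b c d) det =
  mat-cong (trans (diag a b c d) det) (off a b) (off′ c d) (trans (diag′ a b c d) det)
  where
  diag : ∀ a b c d → a *ℤ d +ℤ b *ℤ (- c) ≡ a *ℤ d -ℤ b *ℤ c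
  diag = solve-∀
  diag′ : ∀ a b c d → c *ℤ (- b) +ℤ d *ℤ a ≡ a *ℤ d -ℤ b *ℤ c
  diag′ = solve-∀
  off : ∀ a b → a *ℤ (- b) +ℤ b *ℤ a ≡ + 0
  off = solve-∀
  off′ : ∀ c d → c *ℤ d +ℤ d *ℤ (- c) ≡ + 0
  off′ = solve-∀

·-inverseˡ : ∀ x → SL2 x → inv x · x ≡ I₂
·-inverseˡ (mat a b c d) det =
  mat-cong (trans (diag a b c d) det) (off b d) (off′ a c) (trans (diag′ a b c d) det)
  where
  diag : ∀ a b c d → d *ℤ a +ℤ (- b) *ℤ c ≡ a *ℤ d -ℤ b *ℤ c
  diag = solve-∀
  diag′ : ∀ a b c d → (- c) *ℤ b +ℤ a *ℤ d ≡ a *ℤ d -ℤ b *ℤ c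
  diag′ = solve-∀
  off : ∀ b d → d *ℤ b +ℤ (- b) *ℤ d ≡ + 0
  off = solve-∀
  off′ : ∀ a c → (- c) *ℤ a +ℤ a *ℤ c ≡ + 0
  off′ = solve-∀

SL2-· : ∀ x y → SL2 x → SL2 y → SL2 (x · y)
SL2-· (mat a b c d) (mat e f g h) detx dety =
  trans (det-multiplicative a b c d e f g h) (cong₂ _*ℤ_ detx dety)
  where
  det-multiplicative : ∀ a b c d e f g h →
    (a *ℤ e +ℤ b *ℤ g) *ℤ (c *ℤ f +ℤ d *ℤ h) -ℤ (a *ℤ f +ℤ b *ℤ h) *ℤ (c *ℤ e +ℤ d *ℤ g)
      ≡ (a *ℤ d -ℤ b *ℤ c) *ℤ (e *ℤ h -ℤ f *ℤ g)
  det-multiplicative = solve-∀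

SL2-inv : ∀ x → SL2 x → SL2 (inv x)
SL2-inv (mat a b c d) det = trans (det-adjugate a b c d) det
  where
  det-adjugate : ∀ a b c d → d *ℤ a -ℤ (- b) *ℤ (- c) ≡ a *ℤ d -ℤ b *ℤ c
  det-adjugate = solve-∀

·-monoid : Monoid _ _
·-monoid = record
  { Carrier = M2 ; _≈_ = _≡_ ; _∙_ = _·_ ; ε = I₂
  ; isMonoid = record
    { isSemigroup = record
      { isMagma = record { isEquivalence = isEquivalence ; ∙-cong = cong₂ _·_ }
      ; assoc = ·-assoc }
    ; identity = ·-identityˡ , ·-identityʳ } }

open MonoidSolver ·-monoid using (solve; _⊜_; _⊕_)


·-inverseˡ-cancel : ∀ x y → SL2 y → x · inv y · y ≡ x
·-inverseˡ-cancel x y det =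
  trans (·-assoc x (inv y) y) (trans (cong (x ·_) (·-inverseˡ y det)) (·-identityʳ x))

inv-cancelˡ : ∀ x w → SL2 x → x · (inv x · w) ≡ w
inv-cancelˡ x w det =
  trans (sym (·-assoc x (inv x) w)) (trans (cong (_· w) (·-inverseʳ x det)) (·-identityˡ w))


inv-inv-· : ∀ x y → inv (inv x · y) ≡ inv y · x
inv-inv-· x y = trans (inv-anti-homo-· (inv x) y) (cong (inv y ·_) (inv-involutive x))

inv-·-assoc : ∀ x y w → inv (x · y) · w ≡ inv y · (inv x · w)
inv-·-assoc x y w = trans (cong (_· w) (inv-anti-homo-· x y)) (·-assoc (inv y) (inv x) w)

inv-·-sandwich : ∀ a b g c d → inv (a · b) · g · (c · d) ≡ inv b · (inv a · g · c) · d
inv-·-sandwich a b g c d = begin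
  inv (a · b) · g · (c · d)          ≡⟨ cong (λ u → u · g · (c · d)) (inv-anti-homo-· a b) ⟩
  inv b · inv a · g · (c · d)        ≡⟨ solve 5 (λ a b c d e → ((a ⊕ b) ⊕ c) ⊕ (d ⊕ e) ⊜ (a ⊕ ((b ⊕ c) ⊕ d)) ⊕ e)
                                              refl (inv b) (inv a) g c d ⟩
  inv b · (inv a · g · c) · d        ∎
  where open ≡-Reasoning

-- Subgroups, commutators and the abelianisation

module _ {c ℓ} (M : Monoid c ℓ) where
  open Monoid M renaming (refl to ≈-refl; sym to ≈-sym; trans to ≈-trans)
  open MonoidSum M using (sum)
  open SetoidReasoning setoid

  sum-↑ : ∀ m p (f : Fin (m + p) → Carrier) →
          sum f ≈ sum (λ i → f (i ↑ˡ p)) ∙ sum (λ j → f (m ↑ʳ j))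
  sum-↑ zero    p f = ≈-sym (identityˡ _)
  sum-↑ (suc m) p f = begin
    f zero ∙ sum (λ i → f (suc i))              ≈⟨ ∙-congˡ (sum-↑ m p (λ i → f (suc i))) ⟩
    f zero ∙ (sum (λ i → f (suc (i ↑ˡ p))) ∙ _) ≈⟨ assoc _ _ _ ⟨
    (f zero ∙ sum (λ i → f (suc (i ↑ˡ p)))) ∙ _ ∎

  sum-combine : ∀ m n (f : Fin (m * n) → Carrier) →
                sum f ≈ sum (λ i → sum (λ j → f (combine {m} {n} i j)))
  sum-combine zero    n f = ≈-refl
  sum-combine (suc m) n f = ≈-trans (sum-↑ n (m * n) f) (∙-congˡ (sum-combine m n (λ k → f (n ↑ʳ k))))

module _ {c ℓ} (M : CommutativeMonoid c ℓ) where
  open CommutativeMonoid M using (Carrier; _≈_; reflexive) renaming (trans to ≈-trans)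
  open CommutativeMonoidSum M using (sum; sum-cong-≋; ∑-permute)

  sum-reindex : ∀ {m n} (f : Fin n → Carrier) (π : Permutation m n) (s : Fin m → Fin n) →
                (∀ i → π ⟨$⟩ʳ i ≡ s i) → sum f ≈ sum (λ i → f (s i))
  sum-reindex f π s π≗s = ≈-trans (∑-permute f π) (sum-cong-≋ (λ i → reflexive (cong f (π≗s i))))

record IsSubgroup (P : M2 → Set) : Set where
  field
    ⊆SL2 : ∀ {x} → P x → SL2 x
    I₂∈  : P I₂
    ·∈   : ∀ {x y} → P x → P y → P (x · y)
    inv∈ : ∀ {x} → P x → P (inv x)

prodF∈ : ∀ {P} → IsSubgroup P → ∀ m (f : Fin m → M2) → (∀ i → P (f i)) → P (prodF m f)
prodF∈ S zero    f pf = IsSubgroup.I₂∈ S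
prodF∈ S (suc m) f pf = IsSubgroup.·∈ S (pf zero) (prodF∈ S m (λ i → f (suc i)) (λ i → pf (suc i)))

module Commutators {P : M2 → Set} (S : IsSubgroup P) where
  open IsSubgroup S

  Comm⊆ : ∀ {x} → Comm P x → P x
  Comm⊆ comm-id          = I₂∈
  Comm⊆ (comm-gen px py) = ·∈ (·∈ (·∈ px py) (inv∈ px)) (inv∈ py)
  Comm⊆ (comm-mul c d)   = ·∈ (Comm⊆ c) (Comm⊆ d)

  Comm-inv : ∀ {x} → Comm P x → Comm P (inv x)
  Comm-inv comm-id = comm-id
  Comm-inv (comm-gen {x} {y} px py) = subst (Comm P) (sym inv-commutator) (comm-gen py px)
    where
    open ≡-Reasoning
    inv-commutator : inv (x · y · inv x · inv y) ≡ y · x · inv y · inv x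
    inv-commutator = begin
      inv (x · y · inv x · inv y)             ≡⟨ inv-anti-homo-· (x · y · inv x) (inv y) ⟩
      inv (inv y) · inv (x · y · inv x)       ≡⟨ cong₂ _·_ (inv-involutive y) (inv-anti-homo-· (x · y) (inv x)) ⟩
      y · (inv (inv x) · inv (x · y))         ≡⟨ cong₂ (λ u v → y · (u · v)) (inv-involutive x) (inv-anti-homo-· x y) ⟩
      y · (x · (inv y · inv x))               ≡⟨ solve 4 (λ a b c d → a ⊕ (b ⊕ (c ⊕ d)) ⊜ ((a ⊕ b) ⊕ c) ⊕ d)
                                                       refl y x (inv y) (inv x) ⟩
      y · x · inv y · inv x                   ∎
  Comm-inv (comm-mul {g} {h} c d) = subst (Comm P) (sym (inv-anti-homo-· g h)) (comm-mul (Comm-inv d) (Comm-inv c))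

  -- g c g⁻¹ = [g, c] c
  Comm-conj : ∀ {g c} → P g → Comm P c → Comm P (g · c · inv g)
  Comm-conj {g} {c} pg cc =
    subst (Comm P) (·-inverseˡ-cancel (g · c · inv g) c (⊆SL2 (Comm⊆ cc))) (comm-mul (comm-gen pg (Comm⊆ cc)) cc)

  AbEq-reflexive : ∀ {x y} → P x → x ≡ y → AbEq P x y
  AbEq-reflexive {x} px refl = subst (Comm P) (sym (·-inverseʳ x (⊆SL2 px))) comm-id

  AbEq-sym : ∀ {x y} → AbEq P x y → AbEq P y x
  AbEq-sym {x} {y} xy =
    subst (Comm P) (trans (inv-anti-homo-· x (inv y)) (cong (_· inv x) (inv-involutive y))) (Comm-inv xy)

  AbEq-trans : ∀ {x y z} → P y → AbEq P x y → AbEq P y z → AbEq P x z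
  AbEq-trans {x} {y} {z} py xy yz = subst (Comm P) telescope (comm-mul xy yz)
    where
    telescope : x · inv y · (y · inv z) ≡ x · inv z
    telescope = trans (sym (·-assoc (x · inv y) y (inv z))) (cong (_· inv z) (·-inverseˡ-cancel x y (⊆SL2 py)))

  AbEq-· : ∀ {x x' y y'} → P x → AbEq P x x' → AbEq P y y' → AbEq P (x · y) (x' · y')
  AbEq-· {x} {x'} {y} {y'} px c d = subst (Comm P) regroup (comm-mul (Comm-conj px d) c)
    where
    open ≡-Reasoning
    regroup : x · (y · inv y') · inv x · (x · inv x') ≡ x · y · inv (x' · y')
    regroup = begin
      x · (y · inv y') · inv x · (x · inv x') ≡⟨ solve 5 (λ a b c d e → ((a ⊕ (b ⊕ c)) ⊕ d) ⊕ (a ⊕ e) ⊜ ((a ⊕ b) ⊕ c) ⊕ ((d ⊕ a) ⊕ e))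
                                                        refl x y (inv y') (inv x) (inv x') ⟩
      x · y · inv y' · (inv x · x · inv x')   ≡⟨ cong (λ u → x · y · inv y' · (u · inv x')) (·-inverseˡ x (⊆SL2 px)) ⟩
      x · y · inv y' · (I₂ · inv x')          ≡⟨ cong (x · y · inv y' ·_) (·-identityˡ (inv x')) ⟩
      x · y · inv y' · inv x'                 ≡⟨ ·-assoc (x · y) (inv y') (inv x') ⟩
      x · y · (inv y' · inv x')               ≡⟨ cong (x · y ·_) (sym (inv-anti-homo-· x' y')) ⟩
      x · y · inv (x' · y')                   ∎

  AbEq-comm : ∀ {x y} → P x → P y → AbEq P (x · y) (y · x)
  AbEq-comm {x} {y} px py = subst (Comm P) regroup (comm-gen px py)
    where
    regroup : x · y · inv x · inv y ≡ x · y · inv (y · x)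
    regroup = trans (·-assoc (x · y) (inv x) (inv y)) (cong (x · y ·_) (sym (inv-anti-homo-· y x)))

module Abelianization {P : M2 → Set} (S : IsSubgroup P) where
  open IsSubgroup S
  open Commutators S

  Elem : Set
  Elem = Σ M2 P

  record _≈_ (u v : Elem) : Set where
    constructor ab
    field unab : AbEq P (proj₁ u) (proj₁ v)
  open _≈_ public

  ≈-reflexive : ∀ {u v} → proj₁ u ≡ proj₁ v → u ≈ v
  ≈-reflexive {u} eq = ab (AbEq-reflexive (proj₂ u) eq)

  ≈-refl : ∀ {u} → u ≈ u
  ≈-refl = ≈-reflexive refl

  ≈-sym : ∀ {u v} → u ≈ v → v ≈ u
  ≈-sym {x , _} {y , _} (ab xy) = ab (AbEq-sym {x} {y} xy)

  ≈-trans : ∀ {u v w} → u ≈ v → v ≈ w → u ≈ w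
  ≈-trans {x , _} {y , py} {z , _} (ab xy) (ab yz) = ab (AbEq-trans {x} {y} {z} py xy yz)

  -- Opaque so that conversion checking never expands products into integer entries.
  opaque
    _∙_ : Elem → Elem → Elem
    u ∙ v = proj₁ u · proj₁ v , ·∈ (proj₂ u) (proj₂ v)

    proj₁-∙ : ∀ u v → proj₁ (u ∙ v) ≡ proj₁ u · proj₁ v
    proj₁-∙ u v = refl

  ε : Elem
  ε = I₂ , I₂∈

  ι : Elem → Elem
  ι (x , px) = inv x , inv∈ px

  ∙-cong : ∀ {u u' v v'} → u ≈ u' → v ≈ v' → (u ∙ v) ≈ (u' ∙ v')
  ∙-cong {u} {u'} {v} {v'} (ab c) (ab d) =
    ab (subst₂ (AbEq P) (sym (proj₁-∙ u v)) (sym (proj₁-∙ u' v')) (AbEq-· (proj₂ u) c d))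

  ∙-comm : ∀ u v → (u ∙ v) ≈ (v ∙ u)
  ∙-comm u v = ab (subst₂ (AbEq P) (sym (proj₁-∙ u v)) (sym (proj₁-∙ v u)) (AbEq-comm (proj₂ u) (proj₂ v)))

  ∙-assoc : ∀ u v w → ((u ∙ v) ∙ w) ≈ (u ∙ (v ∙ w))
  ∙-assoc u v w = ≈-reflexive (begin
    proj₁ ((u ∙ v) ∙ w)            ≡⟨ trans (proj₁-∙ (u ∙ v) w) (cong (_· proj₁ w) (proj₁-∙ u v)) ⟩
    proj₁ u · proj₁ v · proj₁ w    ≡⟨ ·-assoc (proj₁ u) (proj₁ v) (proj₁ w) ⟩
    proj₁ u · (proj₁ v · proj₁ w)  ≡⟨ trans (proj₁-∙ u (v ∙ w)) (cong (proj₁ u ·_) (proj₁-∙ v w)) ⟨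
    proj₁ (u ∙ (v ∙ w))            ∎)
    where open ≡-Reasoning

  ∙-identityˡ : ∀ u → (ε ∙ u) ≈ u
  ∙-identityˡ u = ≈-reflexive (trans (proj₁-∙ ε u) (·-identityˡ (proj₁ u)))

  ∙-identityʳ : ∀ u → (u ∙ ε) ≈ u
  ∙-identityʳ u = ≈-reflexive (trans (proj₁-∙ u ε) (·-identityʳ (proj₁ u)))

  ι-inverseˡ : ∀ u → (ι u ∙ u) ≈ ε
  ι-inverseˡ u@(x , px) = ≈-reflexive (trans (proj₁-∙ (ι u) u) (·-inverseˡ x (⊆SL2 px)))

  commutativeMonoid : CommutativeMonoid _ _
  commutativeMonoid = record
    { Carrier = Elem ; _≈_ = _≈_ ; _∙_ = _∙_ ; ε = ε
    ; isCommutativeMonoid = record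
      { isMonoid = record
        { isSemigroup = record
          { isMagma = record
            { isEquivalence = record { refl = ≈-refl ; sym = ≈-sym ; trans = ≈-trans }
            ; ∙-cong = ∙-cong }
          ; assoc = ∙-assoc }
        ; identity = ∙-identityˡ , ∙-identityʳ }
      ; comm = ∙-comm } }

  open CommutativeMonoid commutativeMonoid public using (setoid; monoid)
  open CommutativeMonoidSum commutativeMonoid public
    using (sum; sum-cong-≋; ∑-distrib-+; sum-replicate-zero)

  proj₁-sum : ∀ m (f : Fin m → Elem) → proj₁ (sum f) ≡ prodF m (λ i → proj₁ (f i))
  proj₁-sum zero    f = refl
  proj₁-sum (suc m) f =
    trans (proj₁-∙ (f zero) (sum (λ i → f (suc i)))) (cong (proj₁ (f zero) ·_) (proj₁-sum m (λ i → f (suc i))))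

  sum-ι-inverseˡ : ∀ m (f : Fin m → Elem) → (sum (λ i → ι (f i)) ∙ sum f) ≈ ε
  sum-ι-inverseˡ m f = begin
    sum (λ i → ι (f i)) ∙ sum f  ≈⟨ ∑-distrib-+ (λ i → ι (f i)) f ⟨
    sum (λ i → ι (f i) ∙ f i)    ≈⟨ sum-cong-≋ (λ i → ι-inverseˡ (f i)) ⟩
    sum {m} (λ _ → ε)            ≈⟨ sum-replicate-zero m ⟩
    ε                            ∎
    where open SetoidReasoning setoid

prodF-cong : ∀ m {f g : Fin m → M2} → (∀ i → f i ≡ g i) → prodF m f ≡ prodF m g
prodF-cong zero    f≗g = refl
prodF-cong (suc m) f≗g = cong₂ _·_ (f≗g zero) (prodF-cong m (λ i → f≗g (suc i)))

-- The transfer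

module Transfer {G H : M2 → Set} (SG : IsSubgroup G) (SH : IsSubgroup H)
                (H⊆G : ∀ {x} → H x → G x) (T : Transversal G H) where
  private
    module SG = IsSubgroup SG
    module SH = IsSubgroup SH
  open Abelianization SH

  idx-rep : ∀ i → idx T (rep T i) ≡ i
  idx-rep i = idx-uniq T (rep T i) i (rep∈ T i)
    (subst H (sym (·-inverseˡ (rep T i) (SG.⊆SL2 (rep∈ T i)))) SH.I₂∈)

  idx-·H : ∀ {g h} → G g → H h → idx T (g · h) ≡ idx T g
  idx-·H {g} {h} pg ph = idx-uniq T (g · h) (idx T g) (SG.·∈ pg (H⊆G ph))
    (subst H (·-assoc (inv (rep T (idx T g))) g h) (SH.·∈ (idx-spec T g pg) ph))

  σ : M2 → Fin (n T) → Fin (n T)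
  σ g i = idx T (g · rep T i)

  cocycle : M2 → Fin (n T) → M2
  cocycle g i = inv (rep T (σ g i)) · g · rep T i

  cocycle∈ : ∀ {g} → G g → ∀ i → H (cocycle g i)
  cocycle∈ {g} pg i = subst H (sym (·-assoc (inv (rep T (σ g i))) g (rep T i)))
    (idx-spec T (g · rep T i) (SG.·∈ pg (rep∈ T i)))

  cocycleᴱ : ∀ {g} → G g → Fin (n T) → Elem
  cocycleᴱ pg i = cocycle _ i , cocycle∈ pg i

  opaque
    transferᴬ : ∀ {g} → G g → Elem
    transferᴬ pg = sum (cocycleᴱ pg)

    transferᴬ-unfold : ∀ {g} (pg : G g) → transferᴬ pg ≡ sum (cocycleᴱ pg)
    transferᴬ-unfold pg = refl

  proj₁-transferᴬ : ∀ {g} (pg : G g) → proj₁ (transferᴬ pg) ≡ transfer T g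
  proj₁-transferᴬ pg = trans (cong proj₁ (transferᴬ-unfold pg)) (proj₁-sum (n T) (cocycleᴱ pg))

  transfer∈ : ∀ {g} → G g → H (transfer T g)
  transfer∈ pg = subst H (proj₁-transferᴬ pg) (proj₂ (transferᴬ pg))

  transferᴬ-resp-≡ : ∀ {g g'} (pg : G g) (pg' : G g') → g ≡ g' → transferᴬ pg ≈ transferᴬ pg'
  transferᴬ-resp-≡ pg pg' refl =
    ≈-reflexive (trans (proj₁-transferᴬ pg) (sym (proj₁-transferᴬ pg')))

  rep-σ-cocycle : ∀ {g} → G g → ∀ i → g · rep T i ≡ rep T (σ g i) · cocycle g i
  rep-σ-cocycle {g} pg i = begin
    g · rep T i                                         ≡⟨ inv-cancelˡ (rep T (σ g i)) (g · rep T i) (SG.⊆SL2 (rep∈ T _)) ⟨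
    rep T (σ g i) · (inv (rep T (σ g i)) · (g · rep T i)) ≡⟨ cong (rep T (σ g i) ·_) (·-assoc (inv (rep T (σ g i))) g (rep T i)) ⟨
    rep T (σ g i) · cocycle g i                         ∎
    where open ≡-Reasoning

  σ-· : ∀ {g g'} → G g → G g' → ∀ i → σ (g · g') i ≡ σ g (σ g' i)
  σ-· {g} {g'} pg pg' i = begin
    idx T (g · g' · rep T i)                   ≡⟨ cong (idx T) (·-assoc g g' (rep T i)) ⟩
    idx T (g · (g' · rep T i))                 ≡⟨ cong (λ u → idx T (g · u)) (rep-σ-cocycle pg' i) ⟩
    idx T (g · (rep T (σ g' i) · cocycle g' i)) ≡⟨ cong (idx T) (·-assoc g (rep T (σ g' i)) (cocycle g' i)) ⟨
    idx T (g · rep T (σ g' i) · cocycle g' i)   ≡⟨ idx-·H (SG.·∈ pg (rep∈ T _)) (cocycle∈ pg' i) ⟩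
    σ g (σ g' i)                                ∎
    where open ≡-Reasoning

  σ-inv : ∀ {g} → G g → ∀ i → σ (inv g) (σ g i) ≡ i
  σ-inv {g} pg i = idx-uniq T (inv g · rep T (σ g i)) i (SG.·∈ (SG.inv∈ pg) (rep∈ T _))
    (subst H inv-cocycle (SH.inv∈ (cocycle∈ pg i)))
    where
    open ≡-Reasoning
    inv-cocycle : inv (cocycle g i) ≡ inv (rep T i) · (inv g · rep T (σ g i))
    inv-cocycle = begin
      inv (inv (rep T (σ g i)) · g · rep T i)           ≡⟨ inv-anti-homo-· (inv (rep T (σ g i)) · g) (rep T i) ⟩
      inv (rep T i) · inv (inv (rep T (σ g i)) · g)     ≡⟨ cong (inv (rep T i) ·_) (inv-anti-homo-· (inv (rep T (σ g i))) g) ⟩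
      inv (rep T i) · (inv g · inv (inv (rep T (σ g i)))) ≡⟨ cong (λ u → inv (rep T i) · (inv g · u)) (inv-involutive (rep T (σ g i))) ⟩
      inv (rep T i) · (inv g · rep T (σ g i))           ∎

  σ-permutation : ∀ {g} → G g → Permutation (n T) (n T)
  σ-permutation {g} pg = permutation (σ g) (σ (inv g))
    (λ j → subst (λ u → σ u (σ (inv g) j) ≡ j) (inv-involutive g) (σ-inv (SG.inv∈ pg) j))
    (σ-inv pg)

  cocycle-· : ∀ {g g'} → G g → G g' → ∀ i → cocycle (g · g') i ≡ cocycle g (σ g' i) · cocycle g' i
  cocycle-· {g} {g'} pg pg' i = begin
    inv (rep T (σ (g · g') i)) · (g · g') · rep T i       ≡⟨ cong (λ k → inv (rep T k) · (g · g') · rep T i) (σ-· pg pg' i) ⟩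
    r · (g · g') · rep T i                                ≡⟨ solve 4 (λ a b c d → (a ⊕ (b ⊕ c)) ⊕ d ⊜ (a ⊕ b) ⊕ (c ⊕ d)) refl r g g' (rep T i) ⟩
    r · g · (g' · rep T i)                                ≡⟨ cong (r · g ·_) (inv-cancelˡ (rep T j) (g' · rep T i) (SG.⊆SL2 (rep∈ T j))) ⟨
    r · g · (rep T j · (inv (rep T j) · (g' · rep T i)))  ≡⟨ solve 6 (λ a b c d e f → (a ⊕ b) ⊕ (c ⊕ (d ⊕ (e ⊕ f))) ⊜ ((a ⊕ b) ⊕ c) ⊕ ((d ⊕ e) ⊕ f))
                                                                   refl r g (rep T j) (inv (rep T j)) g' (rep T i) ⟩
    cocycle g j · cocycle g' i                            ∎
    where
    open ≡-Reasoning
    j = σ g' i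
    r = inv (rep T (σ g j))

  transferᴬ-· : ∀ {g g'} (pg : G g) (pg' : G g') → transferᴬ (SG.·∈ pg pg') ≈ (transferᴬ pg ∙ transferᴬ pg')
  transferᴬ-· {g} {g'} pg pg' = begin
    transferᴬ (SG.·∈ pg pg')            ≡⟨ transferᴬ-unfold (SG.·∈ pg pg') ⟩
    sum (cocycleᴱ (SG.·∈ pg pg'))       ≈⟨ sum-cong-≋ split ⟩
    sum (λ i → χ (σ g' i) ∙ χ′ i)       ≈⟨ ∑-distrib-+ (λ i → χ (σ g' i)) χ′ ⟩
    sum (λ i → χ (σ g' i)) ∙ sum χ′     ≈⟨ ∙-cong (≈-sym reindex) ≈-refl ⟩
    sum χ ∙ sum χ′                      ≡⟨ cong₂ _∙_ (transferᴬ-unfold pg) (transferᴬ-unfold pg') ⟨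
    transferᴬ pg ∙ transferᴬ pg'        ∎
    where
    open SetoidReasoning setoid
    χ χ′ : Fin (n T) → Elem
    χ  = cocycleᴱ pg
    χ′ = cocycleᴱ pg'
    split : ∀ i → cocycleᴱ (SG.·∈ pg pg') i ≈ (χ (σ g' i) ∙ χ′ i)
    split i = ≈-reflexive (trans (cocycle-· pg pg' i) (sym (proj₁-∙ (χ (σ g' i)) (χ′ i))))
    reindex : sum χ ≈ sum (λ i → χ (σ g' i))
    reindex = sum-reindex commutativeMonoid χ (σ-permutation pg') (σ g') (λ _ → refl)

  cocycle-I₂ : ∀ i → cocycle I₂ i ≡ I₂
  cocycle-I₂ i = begin
    inv (rep T (idx T (I₂ · rep T i))) · I₂ · rep T i ≡⟨ cong (λ k → inv (rep T k) · I₂ · rep T i) σ-I₂ ⟩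
    inv (rep T i) · I₂ · rep T i                      ≡⟨ cong (_· rep T i) (·-identityʳ (inv (rep T i))) ⟩
    inv (rep T i) · rep T i                           ≡⟨ ·-inverseˡ (rep T i) (SG.⊆SL2 (rep∈ T i)) ⟩
    I₂                                                ∎
    where
    open ≡-Reasoning
    σ-I₂ : idx T (I₂ · rep T i) ≡ i
    σ-I₂ = trans (cong (idx T) (·-identityˡ (rep T i))) (idx-rep i)

  transferᴬ-I₂ : transferᴬ {I₂} SG.I₂∈ ≈ ε
  transferᴬ-I₂ = begin
    transferᴬ SG.I₂∈       ≡⟨ transferᴬ-unfold SG.I₂∈ ⟩
    sum (cocycleᴱ SG.I₂∈)  ≈⟨ sum-cong-≋ (λ i → ≈-reflexive (cocycle-I₂ i)) ⟩
    sum {n T} (λ _ → ε)    ≈⟨ sum-replicate-zero (n T) ⟩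
    ε                      ∎
    where open SetoidReasoning setoid

  transferᴬ-prodF : ∀ m (f : Fin m → M2) (pf : ∀ i → G (f i)) →
                    transferᴬ {prodF m f} (prodF∈ SG m f pf) ≈ sum (λ i → transferᴬ {f i} (pf i))
  transferᴬ-prodF zero    f pf = transferᴬ-I₂
  transferᴬ-prodF (suc m) f pf =
    ≈-trans (transferᴬ-· {f zero} {prodF m (λ i → f (suc i))} (pf zero) pf′)
            (∙-cong ≈-refl (transferᴬ-prodF m (λ i → f (suc i)) (λ i → pf (suc i))))
    where pf′ = prodF∈ SG m (λ i → f (suc i)) (λ i → pf (suc i))

module TransversalIndependence {G H : M2 → Set} (SG : IsSubgroup G) (SH : IsSubgroup H)
         (H⊆G : ∀ {x} → H x → G x) (T T' : Transversal G H) where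
  private
    module SG = IsSubgroup SG
    module SH = IsSubgroup SH
    module A = Transfer SG SH H⊆G T
    module B = Transfer SG SH H⊆G T'
  open Abelianization SH

  π : Fin (n T') → Fin (n T)
  π j = idx T (rep T' j)

  κ : Fin (n T') → M2
  κ j = inv (rep T (π j)) · rep T' j

  κ∈ : ∀ j → H (κ j)
  κ∈ j = idx-spec T (rep T' j) (rep∈ T' j)

  rep′≡rep·κ : ∀ j → rep T' j ≡ rep T (π j) · κ j
  rep′≡rep·κ j = sym (inv-cancelˡ (rep T (π j)) (rep T' j) (SG.⊆SL2 (rep∈ T _)))

  π-permutation : Permutation (n T') (n T)
  π-permutation = permutation π ρ (λ i → idx-swap T T' i) (λ j → idx-swap T' T j)
    where
    ρ : Fin (n T) → Fin (n T')
    ρ i = idx T' (rep T i)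
    idx-swap : ∀ (U U' : Transversal G H) i → idx U (rep U' (idx U' (rep U i))) ≡ i
    idx-swap U U' i = idx-uniq U (rep U' k) i (rep∈ U' k)
      (subst H (inv-inv-· (rep U' k) (rep U i)) (SH.inv∈ (idx-spec U' (rep U i) (rep∈ U i))))
      where k = idx U' (rep U i)

  module _ {g} (pg : G g) where
    π-σ : ∀ j → π (B.σ g j) ≡ A.σ g (π j)
    π-σ j = begin
      idx T (rep T' s)                         ≡⟨ A.idx-·H (rep∈ T' s) (B.cocycle∈ pg j) ⟨
      idx T (rep T' s · B.cocycle g j)         ≡⟨ cong (idx T) (B.rep-σ-cocycle pg j) ⟨
      idx T (g · rep T' j)                     ≡⟨ cong (λ u → idx T (g · u)) (rep′≡rep·κ j) ⟩
      idx T (g · (rep T (π j) · κ j))          ≡⟨ cong (idx T) (·-assoc g (rep T (π j)) (κ j)) ⟨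
      idx T (g · rep T (π j) · κ j)            ≡⟨ A.idx-·H (SG.·∈ pg (rep∈ T _)) (κ∈ j) ⟩
      A.σ g (π j)                              ∎
      where
      open ≡-Reasoning
      s = B.σ g j

    cocycle-change : ∀ j → B.cocycle g j ≡ inv (κ (B.σ g j)) · A.cocycle g (π j) · κ j
    cocycle-change j = begin
      inv (rep T' s) · g · rep T' j                                ≡⟨ cong₂ (λ u v → inv u · g · v) (rep′≡rep·κ s) (rep′≡rep·κ j) ⟩
      inv (rep T (π s) · κ s) · g · (rep T (π j) · κ j)            ≡⟨ cong (λ k → inv (rep T k · κ s) · g · (rep T (π j) · κ j)) (π-σ j) ⟩
      inv (rep T t · κ s) · g · (rep T (π j) · κ j)                ≡⟨ cong (λ u → u · g · (rep T (π j) · κ j)) (inv-anti-homo-· (rep T t) (κ s)) ⟩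
      inv (κ s) · inv (rep T t) · g · (rep T (π j) · κ j)          ≡⟨ solve 5 (λ a b c d e → ((a ⊕ b) ⊕ c) ⊕ (d ⊕ e) ⊜ (a ⊕ ((b ⊕ c) ⊕ d)) ⊕ e)
                                                                              refl (inv (κ s)) (inv (rep T t)) g (rep T (π j)) (κ j) ⟩
      inv (κ s) · A.cocycle g (π j) · κ j                          ∎
      where
      open ≡-Reasoning
      s = B.σ g j
      t = A.σ g (π j)

    transferᴬ-independent : B.transferᴬ pg ≈ A.transferᴬ pg
    transferᴬ-independent = begin
      B.transferᴬ pg                                ≡⟨ B.transferᴬ-unfold pg ⟩
      sum (B.cocycleᴱ pg)                           ≈⟨ sum-cong-≋ change ⟩
      sum (λ j → (κ⁻¹ (B.σ g j) ∙ χ (π j)) ∙ κᴱ j)  ≈⟨ ≈-trans (∑-distrib-+ _ κᴱ) (∙-cong (∑-distrib-+ κ⁻¹∘σ χ∘π) ≈-refl) ⟩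
      (sum κ⁻¹∘σ ∙ sum χ∘π) ∙ sum κᴱ                ≈⟨ ∙-cong (∙-cong (≈-sym reindexκ) (≈-sym reindexχ)) ≈-refl ⟩
      (sum κ⁻¹ ∙ sum χ) ∙ sum κᴱ                    ≈⟨ CMS.solve 3 (λ a b c → (a CMS.⊕ b) CMS.⊕ c CMS.⊜ b CMS.⊕ (a CMS.⊕ c))
                                                                  ≈-refl (sum κ⁻¹) (sum χ) (sum κᴱ) ⟩
      sum χ ∙ (sum κ⁻¹ ∙ sum κᴱ)                    ≈⟨ ∙-cong ≈-refl (sum-ι-inverseˡ (n T') κᴱ) ⟩
      sum χ ∙ ε                                     ≈⟨ ∙-identityʳ (sum χ) ⟩
      sum χ                                         ≡⟨ A.transferᴬ-unfold pg ⟨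
      A.transferᴬ pg                                ∎
      where
      open SetoidReasoning setoid
      module CMS = CommutativeMonoidSolver commutativeMonoid
      χ : Fin (n T) → Elem
      χ = A.cocycleᴱ pg
      κᴱ κ⁻¹ κ⁻¹∘σ χ∘π : Fin (n T') → Elem
      κᴱ j   = κ j , κ∈ j
      κ⁻¹ j  = ι (κᴱ j)
      κ⁻¹∘σ j = κ⁻¹ (B.σ g j)
      χ∘π j  = χ (π j)
      change : ∀ j → B.cocycleᴱ pg j ≈ ((κ⁻¹ (B.σ g j) ∙ χ (π j)) ∙ κᴱ j)
      change j = ≈-reflexive (trans (cocycle-change j)
        (sym (trans (proj₁-∙ (κ⁻¹ (B.σ g j) ∙ χ (π j)) (κᴱ j)) (cong (_· κ j) (proj₁-∙ (κ⁻¹ (B.σ g j)) (χ (π j)))))))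
      reindexκ : sum κ⁻¹ ≈ sum κ⁻¹∘σ
      reindexκ = sum-reindex commutativeMonoid κ⁻¹ (B.σ-permutation pg) (B.σ g) (λ _ → refl)
      reindexχ : sum χ ≈ sum χ∘π
      reindexχ = sum-reindex commutativeMonoid χ π-permutation π (λ _ → refl)

    transfer-independent : AbEq H (transfer T' g) (transfer T g)
    transfer-independent = subst₂ (AbEq H) (B.proj₁-transferᴬ pg) (A.proj₁-transferᴬ pg) (unab transferᴬ-independent)

module Composite {G H K : M2 → Set} (SG : IsSubgroup G) (SH : IsSubgroup H) (SK : IsSubgroup K) (H⊆G : ∀ {x} → H x → G x)
                 (K⊆H : ∀ {x} → K x → H x) (T₁ : Transversal G H) (T₂ : Transversal H K) where
  private
    module SG = IsSubgroup SG
    module SH = IsSubgroup SH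

  unpair : Fin (n T₁ * n T₂) → Fin (n T₁) × Fin (n T₂)
  unpair = remQuot {n T₁} (n T₂)

  repPair : Fin (n T₁) → Fin (n T₂) → M2
  repPair i j = rep T₁ i · rep T₂ j

  idx₁ : M2 → Fin (n T₁)
  idx₁ w = idx T₁ w

  idx₂ : M2 → Fin (n T₂)
  idx₂ w = idx T₂ (inv (rep T₁ (idx₁ w)) · w)

  idxPair-spec : ∀ w → G w → K (inv (repPair (idx₁ w) (idx₂ w)) · w)
  idxPair-spec w pw = subst K (sym (inv-·-assoc (rep T₁ (idx₁ w)) (rep T₂ (idx₂ w)) w))
    (idx-spec T₂ (inv (rep T₁ (idx₁ w)) · w) (idx-spec T₁ w pw))

  idxPair-uniq : ∀ w i j → G w → K (inv (repPair i j) · w) → idx₁ w ≡ i × idx₂ w ≡ j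
  idxPair-uniq w i j pw kw = idx₁≡i , trans (cong (λ k → idx T₂ (inv (rep T₁ k) · w)) idx₁≡i) idx₂≡j
    where
    k∈ : K (inv (rep T₂ j) · (inv (rep T₁ i) · w))
    k∈ = subst K (inv-·-assoc (rep T₁ i) (rep T₂ j) w) kw
    h∈ : H (inv (rep T₁ i) · w)
    h∈ = subst H (inv-cancelˡ (rep T₂ j) (inv (rep T₁ i) · w) (SH.⊆SL2 (rep∈ T₂ j)))
               (SH.·∈ (rep∈ T₂ j) (K⊆H k∈))
    idx₁≡i : idx₁ w ≡ i
    idx₁≡i = idx-uniq T₁ w i pw h∈
    idx₂≡j : idx T₂ (inv (rep T₁ i) · w) ≡ j
    idx₂≡j = idx-uniq T₂ (inv (rep T₁ i) · w) j h∈ k∈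

  composite : Transversal G K
  composite = record
    { n        = n T₁ * n T₂
    ; rep      = λ k → repPair (proj₁ (unpair k)) (proj₂ (unpair k))
    ; rep∈     = λ k → SG.·∈ (rep∈ T₁ _) (H⊆G (rep∈ T₂ _))
    ; idx      = λ w → combine (idx₁ w) (idx₂ w)
    ; idx-spec = λ w pw → subst (λ (p : Fin _ × Fin _) → K (inv (repPair (proj₁ p) (proj₂ p)) · w))
                                (sym (remQuot-combine (idx₁ w) (idx₂ w))) (idxPair-spec w pw)
    ; idx-uniq = λ w k pw kw → let (e₁ , e₂) = idxPair-uniq w _ _ pw kw in
                   trans (cong₂ combine e₁ e₂) (combine-remQuot {n T₁} (n T₂) k)
    }

  private
    module T₁ = Transfer SG SH H⊆G T₁
    module T₂ = Transfer SH SK K⊆H T₂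
    module T₁₂ = Transfer SG SK (λ k → H⊆G (K⊆H k)) composite
  open Abelianization SK

  rep-combine : ∀ i j → rep composite (combine i j) ≡ repPair i j
  rep-combine i j = cong (λ p → repPair (proj₁ p) (proj₂ p)) (remQuot-combine i j)

  module _ {g} (pg : G g) where
    σ-combine : ∀ i j → T₁₂.σ g (combine i j) ≡ combine (T₁.σ g i) (T₂.σ (T₁.cocycle g i) j)
    σ-combine i j = idx-uniq composite (g · rep composite (combine i j)) (combine i′ j′)
      (SG.·∈ pg (rep∈ composite (combine i j)))
      (subst K cocycle≡ (T₂.cocycle∈ (T₁.cocycle∈ pg i) j))
      where
      open ≡-Reasoning
      i′ = T₁.σ g i
      j′ = T₂.σ (T₁.cocycle g i) j
      cocycle≡ : T₂.cocycle (T₁.cocycle g i) j ≡ inv (rep composite (combine i′ j′)) · (g · rep composite (combine i j))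
      cocycle≡ = begin
        inv (rep T₂ j′) · T₁.cocycle g i · rep T₂ j                      ≡⟨ inv-·-sandwich (rep T₁ i′) (rep T₂ j′) g (rep T₁ i) (rep T₂ j) ⟨
        inv (repPair i′ j′) · g · repPair i j                            ≡⟨ ·-assoc (inv (repPair i′ j′)) g (repPair i j) ⟩
        inv (repPair i′ j′) · (g · repPair i j)                          ≡⟨ cong₂ (λ u v → inv u · (g · v)) (rep-combine i′ j′) (rep-combine i j) ⟨
        inv (rep composite (combine i′ j′)) · (g · rep composite (combine i j)) ∎

    cocycle-combine : ∀ i j → T₁₂.cocycle g (combine i j) ≡ T₂.cocycle (T₁.cocycle g i) j
    cocycle-combine i j = begin
      inv (rep composite (T₁₂.σ g (combine i j))) · g · rep composite (combine i j)
        ≡⟨ cong₂ (λ u v → inv u · g · v) (trans (cong (rep composite) (σ-combine i j)) (rep-combine i′ j′)) (rep-combine i j) ⟩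
      inv (repPair i′ j′) · g · repPair i j
        ≡⟨ inv-·-sandwich (rep T₁ i′) (rep T₂ j′) g (rep T₁ i) (rep T₂ j) ⟩
      inv (rep T₂ j′) · T₁.cocycle g i · rep T₂ j ∎
      where
      open ≡-Reasoning
      i′ = T₁.σ g i
      j′ = T₂.σ (T₁.cocycle g i) j

    transferᴬ-composite : (ph : H (transfer T₁ g)) → T₁₂.transferᴬ pg ≈ T₂.transferᴬ ph
    transferᴬ-composite ph = begin
      T₁₂.transferᴬ pg                                                   ≡⟨ T₁₂.transferᴬ-unfold pg ⟩
      sum (T₁₂.cocycleᴱ pg)                                              ≈⟨ sum-combine monoid (n T₁) (n T₂) (T₁₂.cocycleᴱ pg) ⟩
      sum (λ i → sum (λ j → T₁₂.cocycleᴱ pg (combine {n T₁} {n T₂} i j)))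
        ≈⟨ sum-cong-≋ (λ i → sum-cong-≋ (λ j → ≈-reflexive (cocycle-combine i j))) ⟩
      sum (λ i → sum (T₂.cocycleᴱ (T₁.cocycle∈ pg i)))
        ≈⟨ sum-cong-≋ (λ i → ≈-reflexive (cong proj₁ (T₂.transferᴬ-unfold (T₁.cocycle∈ pg i)))) ⟨
      sum (λ i → T₂.transferᴬ (T₁.cocycle∈ pg i))                        ≈⟨ T₂.transferᴬ-prodF (n T₁) (T₁.cocycle g) (T₁.cocycle∈ pg) ⟨
      T₂.transferᴬ (prodF∈ SH (n T₁) (T₁.cocycle g) (T₁.cocycle∈ pg))    ≈⟨ T₂.transferᴬ-resp-≡ _ ph refl ⟩
      T₂.transferᴬ ph                                                    ∎
      where open SetoidReasoning setoid

    transfer-composite : AbEq K (transfer composite g) (transfer T₂ (transfer T₁ g))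
    transfer-composite = subst₂ (AbEq K) (T₁₂.proj₁-transferᴬ pg) (T₂.proj₁-transferᴬ ph) (unab (transferᴬ-composite ph))
      where ph = T₁.transfer∈ pg

record IsHomomorphismOn (P : M2 → Set) (φ : M2 → M2) : Set where
  field
    homo-I₂  : φ I₂ ≡ I₂
    homo-·   : ∀ x y → P x → P y → φ (x · y) ≡ φ x · φ y
    homo-inv : ∀ x → P x → φ (inv x) ≡ inv (φ x)

module _ {P : M2 → Set} (S : IsSubgroup P) {φ : M2 → M2} (hom : IsHomomorphismOn P φ) where
  private
    module S = IsSubgroup S
  open IsHomomorphismOn hom

  homo-prodF : ∀ m (f : Fin m → M2) → (∀ i → P (f i)) → φ (prodF m f) ≡ prodF m (λ i → φ (f i))
  homo-prodF zero    f pf = homo-I₂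
  homo-prodF (suc m) f pf =
    trans (homo-· (f zero) (prodF m (λ i → f (suc i))) (pf zero) (prodF∈ S m (λ i → f (suc i)) (λ i → pf (suc i))))
          (cong (φ (f zero) ·_) (homo-prodF m (λ i → f (suc i)) (λ i → pf (suc i))))

  Comm-map : ∀ {Q : M2 → Set} → (∀ {x} → P x → Q (φ x)) → ∀ {z} → Comm P z → Comm Q (φ z)
  Comm-map {Q} φ∈ comm-id = subst (Comm Q) (sym homo-I₂) comm-id
  Comm-map {Q} φ∈ (comm-gen {x} {y} px py) = subst (Comm Q) (sym φ-commutator) (comm-gen (φ∈ px) (φ∈ py))
    where
    open ≡-Reasoning
    φ-commutator : φ (x · y · inv x · inv y) ≡ φ x · φ y · inv (φ x) · inv (φ y)
    φ-commutator = begin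
      φ (x · y · inv x · inv y)             ≡⟨ homo-· (x · y · inv x) (inv y) (S.·∈ (S.·∈ px py) (S.inv∈ px)) (S.inv∈ py) ⟩
      φ (x · y · inv x) · φ (inv y)         ≡⟨ cong₂ _·_ (homo-· (x · y) (inv x) (S.·∈ px py) (S.inv∈ px)) (homo-inv y py) ⟩
      φ (x · y) · φ (inv x) · inv (φ y)     ≡⟨ cong₂ (λ u v → u · v · inv (φ y)) (homo-· x y px py) (homo-inv x px) ⟩
      φ x · φ y · inv (φ x) · inv (φ y)     ∎
  Comm-map {Q} φ∈ (comm-mul {g} {h} c d) =
    subst (Comm Q) (sym (homo-· g h (Comm⊆ c) (Comm⊆ d))) (comm-mul (Comm-map φ∈ c) (Comm-map φ∈ d))
    where open Commutators S

module _ {G H : M2 → Set} (SG : IsSubgroup G) (SH : IsSubgroup H) (H⊆G : ∀ {x} → H x → G x) where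
  private
    module SG = IsSubgroup SG
    module SH = IsSubgroup SH

  shift : (T : Transversal G H) (h : Fin (n T) → M2) → (∀ i → H (h i)) → Transversal G H
  shift T h h∈ = record
    { n        = n T
    ; rep      = λ i → rep T i · h i
    ; rep∈     = λ i → SG.·∈ (rep∈ T i) (H⊆G (h∈ i))
    ; idx      = idx T
    ; idx-spec = λ w pw → let i = idx T w in
        subst H (sym (inv-·-assoc (rep T i) (h i) w)) (SH.·∈ (SH.inv∈ (h∈ i)) (idx-spec T w pw))
    ; idx-uniq = λ w i pw hw →
        idx-uniq T w i pw (subst H (unshift i w) (SH.·∈ (h∈ i) hw))
    }
    where
    unshift : ∀ i w → h i · (inv (rep T i · h i) · w) ≡ inv (rep T i) · w
    unshift i w = trans (cong (h i ·_) (inv-·-assoc (rep T i) (h i) w))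
                        (inv-cancelˡ (h i) (inv (rep T i) · w) (SH.⊆SL2 (h∈ i)))

module Pullback {A B G H : M2 → Set} (SA : IsSubgroup A)
                {φ : M2 → M2} (hom : IsHomomorphismOn A φ)
                (φ-A : ∀ {x} → A x → G (φ x)) (φ-B : ∀ {x} → B x → H (φ x))
                (φ⁻¹-H : ∀ {x} → A x → H (φ x) → B x)
                (T : Transversal G H) (z : Fin (n T) → M2) (z∈ : ∀ i → A (z i))
                (φ-z : ∀ i → φ (z i) ≡ rep T i) where
  private
    module SA = IsSubgroup SA
  open IsHomomorphismOn hom

  φ-inv-· : ∀ i {w} → A w → φ (inv (z i) · w) ≡ inv (rep T i) · φ w
  φ-inv-· i {w} pw = begin
    φ (inv (z i) · w)      ≡⟨ homo-· (inv (z i)) w (SA.inv∈ (z∈ i)) pw ⟩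
    φ (inv (z i)) · φ w    ≡⟨ cong (_· φ w) (homo-inv (z i) (z∈ i)) ⟩
    inv (φ (z i)) · φ w    ≡⟨ cong (λ u → inv u · φ w) (φ-z i) ⟩
    inv (rep T i) · φ w    ∎
    where open ≡-Reasoning

  pullback : Transversal A B
  pullback = record
    { n        = n T
    ; rep      = z
    ; rep∈     = z∈
    ; idx      = λ w → idx T (φ w)
    ; idx-spec = λ w pw → let i = idx T (φ w) in
        φ⁻¹-H (SA.·∈ (SA.inv∈ (z∈ i)) pw) (subst H (sym (φ-inv-· i pw)) (idx-spec T (φ w) (φ-A pw)))
    ; idx-uniq = λ w i pw bw → idx-uniq T (φ w) i (φ-A pw) (subst H (φ-inv-· i pw) (φ-B bw))
    }

  φ-transfer : ∀ {u} → A u → φ (transfer pullback u) ≡ transfer T (φ u)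
  φ-transfer {u} pu = trans (homo-prodF SA hom (n T) cocycle cocycle∈) (prodF-cong (n T) φ-cocycle)
    where
    σ : Fin (n T) → Fin (n T)
    σ i = idx T (φ (u · z i))
    cocycle : Fin (n T) → M2
    cocycle i = inv (z (σ i)) · u · z i
    cocycle∈ : ∀ i → A (cocycle i)
    cocycle∈ i = SA.·∈ (SA.·∈ (SA.inv∈ (z∈ (σ i))) pu) (z∈ i)
    φ-cocycle : ∀ i → φ (cocycle i) ≡ inv (rep T (idx T (φ u · rep T i))) · φ u · rep T i
    φ-cocycle i = begin
      φ (inv (z (σ i)) · u · z i)              ≡⟨ homo-· (inv (z (σ i)) · u) (z i) (SA.·∈ (SA.inv∈ (z∈ (σ i))) pu) (z∈ i) ⟩
      φ (inv (z (σ i)) · u) · φ (z i)          ≡⟨ cong₂ _·_ (φ-inv-· (σ i) pu) (φ-z i) ⟩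
      inv (rep T (σ i)) · φ u · rep T i        ≡⟨ cong (λ k → inv (rep T (idx T k)) · φ u · rep T i) φ-u·z ⟩
      inv (rep T (idx T (φ u · rep T i))) · φ u · rep T i ∎
      where
      open ≡-Reasoning
      φ-u·z : φ (u · z i) ≡ φ u · rep T i
      φ-u·z = trans (homo-· u (z i) pu (z∈ i)) (cong (φ u ·_) (φ-z i))

restrict : ∀ {P Q : M2 → Set} {φ} → (∀ {x} → Q x → P x) → IsHomomorphismOn P φ → IsHomomorphismOn Q φ
restrict Q⊆P hom = record
  { homo-I₂ = homo-I₂ ; homo-· = λ x y qx qy → homo-· x y (Q⊆P qx) (Q⊆P qy) ; homo-inv = λ x qx → homo-inv x (Q⊆P qx) }
  where open IsHomomorphismOn hom

AbEq-map : ∀ {P Q : M2 → Set} (S : IsSubgroup P) {φ} → IsHomomorphismOn P φ → (∀ {x} → P x → Q (φ x)) →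
           ∀ {x y} → P x → P y → AbEq P x y → AbEq Q (φ x) (φ y)
AbEq-map {P} {Q} S {φ} hom φ∈ {x} {y} px py xy =
  subst (Comm Q) φ-x·y⁻¹ (Comm-map S hom φ∈ xy)
  where
  open IsHomomorphismOn hom
  φ-x·y⁻¹ : φ (x · inv y) ≡ φ x · inv (φ y)
  φ-x·y⁻¹ = trans (homo-· x (inv y) px (IsSubgroup.inv∈ S py)) (cong (φ x ·_) (homo-inv y py))

-- Congruence subgroups and conjugation by t

^-monoʳ-∣ : ∀ k {m n} → m ≤ n → k ^ m ∣ k ^ n
^-monoʳ-∣ k {m} {n} m≤n = divides (k ^ (n ∸ m))
  (trans (cong (k ^_) (sym (m+[n∸m]≡n m≤n))) (trans (^-distribˡ-+-* k m (n ∸ m)) (*-comm (k ^ m) (k ^ (n ∸ m)))))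

odd⇒1+2ν : ∀ n → ¬ 2 ∣ n → Σ ℕ (λ ν → n ≡ 1 + ν * 2)
odd⇒1+2ν n ¬2∣n with n % 2 | m≡m%n+[m/n]*n n 2 | m%n<n n 2 | m%n≡0⇒n∣m n 2
... | 0           | _ | _              | 2∣n = ⊥-elim (¬2∣n (2∣n refl))
... | 1           | n≡1+[n/2]*2 | _    | _   = n / 2 , n≡1+[n/2]*2
... | suc (suc _) | _ | s≤s (s≤s ())   | _

odd-∣-2*⇒∣ : ∀ {n ν t} → n ≡ 1 + ν * 2 → n ∣ 2 * t → n ∣ t
odd-∣-2*⇒∣ {n} {ν} {t} refl n∣2t = ∣m+n∣m⇒∣n (subst (n ∣_) (expand ν t) (m∣m*n t)) (∣n⇒∣m*n ν n∣2t)
  where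
  expand : ∀ ν t → (1 + ν * 2) * t ≡ ν * (2 * t) + t
  expand = ℕ-Tactic.solve-∀

*odd-∣-2*⇒∣ : ∀ k {n ν m} .{{_ : NonZero k}} → n ≡ 1 + ν * 2 → k ∣ m → k * n ∣ 2 * m → k * n ∣ m
*odd-∣-2*⇒∣ k {n} {ν} n≡1+2ν (divides t refl) kn∣2m =
  subst (k * n ∣_) (*-comm k t) (*-monoʳ-∣ k (odd-∣-2*⇒∣ {n} {ν} n≡1+2ν (*-cancelˡ-∣ k (subst (k * n ∣_) (regroup t k) kn∣2m))))
  where
  regroup : ∀ t k → 2 * (t * k) ≡ k * (2 * t)
  regroup = ℕ-Tactic.solve-∀

∣ℤ-+ : ∀ {k} m n → + k ∣ℤ m → + k ∣ℤ n → + k ∣ℤ m +ℤ n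
∣ℤ-+ {k} m n k∣m k∣n =
  Signed.∣⇒∣ᵤ {+ k} {m +ℤ n} (Signed.∣m∣n⇒∣m+n (Signed.∣ᵤ⇒∣ {+ k} {m} k∣m) (Signed.∣ᵤ⇒∣ {+ k} {n} k∣n))

∣ℤ-*ˡ : ∀ {k} m n → + k ∣ℤ n → + k ∣ℤ m *ℤ n
∣ℤ-*ˡ {k} m n k∣n = Signed.∣⇒∣ᵤ {+ k} {m *ℤ n} (Signed.∣n⇒∣m*n m (Signed.∣ᵤ⇒∣ {+ k} {n} k∣n))

∣ℤ-*ʳ : ∀ {k} m n → + k ∣ℤ m → + k ∣ℤ m *ℤ n
∣ℤ-*ʳ {k} m n k∣m = Signed.∣⇒∣ᵤ {+ k} {m *ℤ n} (Signed.∣m⇒∣m*n n (Signed.∣ᵤ⇒∣ {+ k} {m} k∣m))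

∣ℤ-neg : ∀ {k} m → + k ∣ℤ m → + k ∣ℤ - m
∣ℤ-neg {k} m k∣m = Signed.∣⇒∣ᵤ {+ k} { - m} (Signed.∣m⇒∣-m (Signed.∣ᵤ⇒∣ {+ k} {m} k∣m))

∣ℤ-0 : ∀ k → + k ∣ℤ + 0
∣ℤ-0 k = k ∣0

Γ₁-isSubgroup : ∀ m → IsSubgroup (Γ₁ m)
Γ₁-isSubgroup m = record
  { ⊆SL2 = proj₁ ; I₂∈ = refl , ∣ℤ-0 m , ∣ℤ-0 m , ∣ℤ-0 m ; ·∈ = λ {x} {y} → ·∈ {x} {y} ; inv∈ = λ {x} → inv∈ {x} }
  where
  ·∈ : ∀ {x y} → Γ₁ m x → Γ₁ m y → Γ₁ m (x · y)
  ·∈ {mat a b c d} {mat e f g h} (detx , ax , cx , dx) (dety , ay , cy , dy) =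
    SL2-· (mat a b c d) (mat e f g h) detx dety ,
    subst (+ m ∣ℤ_) (a-entry a b e g)
      (∣ℤ-+ ((a -ℤ + 1) *ℤ e +ℤ (e -ℤ + 1)) (b *ℤ g) (∣ℤ-+ ((a -ℤ + 1) *ℤ e) (e -ℤ + 1) (∣ℤ-*ʳ (a -ℤ + 1) e ax) ay) (∣ℤ-*ˡ b g cy)) ,
    ∣ℤ-+ (c *ℤ e) (d *ℤ g) (∣ℤ-*ʳ c e cx) (∣ℤ-*ˡ d g cy) ,
    subst (+ m ∣ℤ_) (d-entry c d f h)
      (∣ℤ-+ (c *ℤ f +ℤ (d -ℤ + 1) *ℤ h) (h -ℤ + 1) (∣ℤ-+ (c *ℤ f) ((d -ℤ + 1) *ℤ h) (∣ℤ-*ʳ c f cx) (∣ℤ-*ʳ (d -ℤ + 1) h dx)) dy)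
    where
    a-entry : ∀ a b e g → (a -ℤ + 1) *ℤ e +ℤ (e -ℤ + 1) +ℤ b *ℤ g ≡ a *ℤ e +ℤ b *ℤ g -ℤ + 1
    a-entry = solve-∀
    d-entry : ∀ c d f h → c *ℤ f +ℤ (d -ℤ + 1) *ℤ h +ℤ (h -ℤ + 1) ≡ c *ℤ f +ℤ d *ℤ h -ℤ + 1
    d-entry = solve-∀
  inv∈ : ∀ {x} → Γ₁ m x → Γ₁ m (inv x)
  inv∈ {mat a b c d} (det , ax , cx , dx) = SL2-inv (mat a b c d) det , dx , ∣ℤ-neg c cx , ax

Γ₀-isSubgroup : ∀ m → IsSubgroup (Γ₀ m)
Γ₀-isSubgroup m = record
  { ⊆SL2 = proj₁ ; I₂∈ = refl , ∣ℤ-0 m ; ·∈ = λ {x} {y} → ·∈ {x} {y} ; inv∈ = λ {x} → inv∈ {x} }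
  where
  ·∈ : ∀ {x y} → Γ₀ m x → Γ₀ m y → Γ₀ m (x · y)
  ·∈ {mat a b c d} {mat e f g h} (detx , cx) (dety , cy) =
    SL2-· (mat a b c d) (mat e f g h) detx dety , ∣ℤ-+ (c *ℤ e) (d *ℤ g) (∣ℤ-*ʳ c e cx) (∣ℤ-*ˡ d g cy)
  inv∈ : ∀ {x} → Γ₀ m x → Γ₀ m (inv x)
  inv∈ {mat a b c d} (det , cx) = SL2-inv (mat a b c d) det , ∣ℤ-neg c cx

Γ⁰2-isSubgroup : IsSubgroup Γ⁰2
Γ⁰2-isSubgroup = record
  { ⊆SL2 = proj₁ ; I₂∈ = refl , ∣ℤ-0 2 ; ·∈ = λ {x} {y} → ·∈ {x} {y} ; inv∈ = λ {x} → inv∈ {x} }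
  where
  ·∈ : ∀ {x y} → Γ⁰2 x → Γ⁰2 y → Γ⁰2 (x · y)
  ·∈ {mat a b c d} {mat e f g h} (detx , bx) (dety , by) =
    SL2-· (mat a b c d) (mat e f g h) detx dety , ∣ℤ-+ (a *ℤ f) (b *ℤ h) (∣ℤ-*ˡ a f by) (∣ℤ-*ʳ b h bx)
  inv∈ : ∀ {x} → Γ⁰2 x → Γ⁰2 (inv x)
  inv∈ {mat a b c d} (det , bx) = SL2-inv (mat a b c d) det , ∣ℤ-neg b bx

∩-isSubgroup : ∀ {P Q} → IsSubgroup P → IsSubgroup Q → IsSubgroup (P ∩ Q)
∩-isSubgroup SP SQ = record
  { ⊆SL2 = λ {x} p → P.⊆SL2 {x} (proj₁ p)
  ; I₂∈  = P.I₂∈ , Q.I₂∈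
  ; ·∈   = λ {x} {y} p q → P.·∈ {x} {y} (proj₁ p) (proj₁ q) , Q.·∈ {x} {y} (proj₂ p) (proj₂ q)
  ; inv∈ = λ {x} p → P.inv∈ {x} (proj₁ p) , Q.inv∈ {x} (proj₂ p) }
  where
  module P = IsSubgroup SP
  module Q = IsSubgroup SQ

k*2/ℕ2≡k : ∀ k → (k *ℤ + 2) /ℕ 2 ≡ k
k*2/ℕ2≡k (+ m) = trans (cong (_/ℕ 2) (sym (ℤ.pos-* m 2))) (cong +_ (m*n/n≡m m 2))
k*2/ℕ2≡k -[1+ m ] with suc (suc (m * 2)) % 2 | m*n%n≡0 (suc m) 2
... | .0 | refl = cong (λ u → - (+ u)) (m*n/n≡m (suc m) 2)

even⇒*2 : ∀ z → + 2 ∣ℤ z → Σ ℤ (λ k → z ≡ k *ℤ + 2)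
even⇒*2 z 2∣z with Signed.∣ᵤ⇒∣ {+ 2} {z} 2∣z
... | Signed.divides k z≡k*2 = k , z≡k*2

conj-t-· : ∀ x y → + 2 ∣ℤ b x → + 2 ∣ℤ b y → conj-t (x · y) ≡ conj-t x · conj-t y
conj-t-· (mat a b c d) (mat e f g h) 2∣b 2∣f with even⇒*2 b 2∣b | even⇒*2 f 2∣f
... | β , refl | φ , refl =
  mat-cong (trans (a′ a β e g) (cong (λ u → a *ℤ e +ℤ u *ℤ (+ 2 *ℤ g)) (sym (k*2/ℕ2≡k β))))
           (trans (cong (_/ℕ 2) (b′ a β φ h))
                  (trans (k*2/ℕ2≡k (a *ℤ φ +ℤ β *ℤ h)) (sym (cong₂ (λ u v → a *ℤ u +ℤ v *ℤ h) (k*2/ℕ2≡k φ) (k*2/ℕ2≡k β)))))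
           (c′ c d e g)
           (trans (d′ c d φ h) (cong (λ v → + 2 *ℤ c *ℤ v +ℤ d *ℤ h) (sym (k*2/ℕ2≡k φ))))
  where
  a′ : ∀ a β e g → a *ℤ e +ℤ β *ℤ + 2 *ℤ g ≡ a *ℤ e +ℤ β *ℤ (+ 2 *ℤ g)
  a′ = solve-∀
  b′ : ∀ a β φ h → a *ℤ (φ *ℤ + 2) +ℤ β *ℤ + 2 *ℤ h ≡ (a *ℤ φ +ℤ β *ℤ h) *ℤ + 2
  b′ = solve-∀
  c′ : ∀ c d e g → + 2 *ℤ (c *ℤ e +ℤ d *ℤ g) ≡ + 2 *ℤ c *ℤ e +ℤ d *ℤ (+ 2 *ℤ g)
  c′ = solve-∀
  d′ : ∀ c d φ h → c *ℤ (φ *ℤ + 2) +ℤ d *ℤ h ≡ + 2 *ℤ c *ℤ φ +ℤ d *ℤ h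
  d′ = solve-∀

conj-t-inv : ∀ x → + 2 ∣ℤ b x → conj-t (inv x) ≡ inv (conj-t x)
conj-t-inv (mat a b c d) 2∣b with even⇒*2 b 2∣b
... | β , refl =
  mat-cong refl (trans (cong (_/ℕ 2) (b′ β)) (trans (k*2/ℕ2≡k (- β)) (cong -_ (sym (k*2/ℕ2≡k β))))) (c′ c) refl
  where
  b′ : ∀ β → - (β *ℤ + 2) ≡ (- β) *ℤ + 2
  b′ = solve-∀
  c′ : ∀ c → + 2 *ℤ (- c) ≡ - (+ 2 *ℤ c)
  c′ = solve-∀

conj-t-SL2 : ∀ x → + 2 ∣ℤ b x → SL2 x → SL2 (conj-t x)
conj-t-SL2 (mat a b c d) 2∣b det with even⇒*2 b 2∣b
... | β , refl = trans (cong (λ u → a *ℤ d -ℤ u *ℤ (+ 2 *ℤ c)) (k*2/ℕ2≡k β)) (trans (det′ a β c d) det)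
  where
  det′ : ∀ a β c d → a *ℤ d -ℤ β *ℤ (+ 2 *ℤ c) ≡ a *ℤ d -ℤ β *ℤ + 2 *ℤ c
  det′ = solve-∀

conj-t-Γ₁ : ∀ m x → + 2 ∣ℤ b x → Γ₁ m x → Γ₁ m (conj-t x)
conj-t-Γ₁ m x@(mat a b c d) 2∣b (det , ax , cx , dx) = conj-t-SL2 x 2∣b det , ax , ∣ℤ-*ˡ (+ 2) c cx , dx

conj-t-Γ₀ : ∀ m x → + 2 ∣ℤ b x → Γ₀ m x → Γ₀ m (conj-t x)
conj-t-Γ₀ m x@(mat a b c d) 2∣b (det , cx) = conj-t-SL2 x 2∣b det , ∣ℤ-*ˡ (+ 2) c cx

untwist : M2 → ℤ → M2
untwist y k = mat (a y) (+ 2 *ℤ b y) k (d y)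

conj-t-untwist : ∀ y k → c y ≡ + 2 *ℤ k → conj-t (untwist y k) ≡ y
conj-t-untwist (mat a b c d) k refl =
  mat-cong refl (trans (cong (_/ℕ 2) (ℤ.*-comm (+ 2) b)) (k*2/ℕ2≡k b)) refl refl

SL2-untwist : ∀ y k → c y ≡ + 2 *ℤ k → SL2 y → SL2 (untwist y k)
SL2-untwist (mat a b c d) k refl det = trans (det′ a b d k) det
  where
  det′ : ∀ a b d k → a *ℤ d -ℤ (+ 2 *ℤ b) *ℤ k ≡ a *ℤ d -ℤ b *ℤ (+ 2 *ℤ k)
  det′ = solve-∀

1+odd*odd-even : ∀ m n → + 2 ∣ℤ m -ℤ + 1 → + 2 ∣ℤ n -ℤ + 1 → + 2 ∣ℤ + 1 +ℤ m *ℤ n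
1+odd*odd-even m n 2∣m-1 2∣n-1 = subst (+ 2 ∣ℤ_) (expand m n)
  (∣ℤ-+ ((m -ℤ + 1) *ℤ (n -ℤ + 1) +ℤ (m -ℤ + 1)) ((n -ℤ + 1) +ℤ + 2)
       (∣ℤ-+ ((m -ℤ + 1) *ℤ (n -ℤ + 1)) (m -ℤ + 1) (∣ℤ-*ʳ (m -ℤ + 1) (n -ℤ + 1) 2∣m-1) 2∣m-1)
       (∣ℤ-+ (n -ℤ + 1) (+ 2) 2∣n-1 (∣-refl {2})))
  where
  expand : ∀ m n → (m -ℤ + 1) *ℤ (n -ℤ + 1) +ℤ (m -ℤ + 1) +ℤ ((n -ℤ + 1) +ℤ + 2) ≡ + 1 +ℤ m *ℤ n
  expand = solve-∀

conj-t-hom : IsHomomorphismOn Γ⁰2 conj-t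
conj-t-hom = record
  { homo-I₂ = refl
  ; homo-· = λ x y px py → conj-t-· x y (proj₂ px) (proj₂ py)
  ; homo-inv = λ x px → conj-t-inv x (proj₂ px) }

-- The transfer V and the Atkin operator

-- Rewriting with this lemma, instead of leaving it to conversion, keeps the type checker from
-- unfolding transfer (and then the matrix products) first.
atkinU-unfold : ∀ {G} (T : Transversal G (G ∩ Γ⁰2)) g → atkinU T g ≡ conj-t (transfer T g)
atkinU-unfold T g = refl

module AtkinSetting (N r s : ℕ) (N-odd : ¬ 2 ∣ N) (2≤s : 2 ≤ s) (s≤r : s ≤ r) where
  M M′ : ℕ
  M  = 2 ^ r * N
  M′ = 2 ^ s * N

  G H A B : M2 → Set
  G = Φ N r s
  H = Γ₁ M
  A = G ∩ Γ⁰2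
  B = H ∩ Γ⁰2

  SG : IsSubgroup G
  SG = ∩-isSubgroup (Γ₁-isSubgroup M′) (Γ₀-isSubgroup (2 ^ r))
  SH : IsSubgroup H
  SH = Γ₁-isSubgroup M
  SA : IsSubgroup A
  SA = ∩-isSubgroup SG Γ⁰2-isSubgroup
  SB : IsSubgroup B
  SB = ∩-isSubgroup SH Γ⁰2-isSubgroup

  M′∣M : M′ ∣ M
  M′∣M = *-monoˡ-∣ N (^-monoʳ-∣ 2 s≤r)

  2∣M′ : 2 ∣ M′
  2∣M′ = ∣-trans (^-monoʳ-∣ 2 {1} (≤-trans (s≤s z≤n) 2≤s)) (m∣m*n N)

  ν : ℕ
  ν = proj₁ (odd⇒1+2ν N N-odd)

  N≡1+2ν : N ≡ 1 + ν * 2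
  N≡1+2ν = proj₂ (odd⇒1+2ν N N-odd)

  H⊆G : ∀ {x} → H x → G x
  H⊆G (det , a-1 , c , d-1) = (det , ∣-trans M′∣M a-1 , ∣-trans M′∣M c , ∣-trans M′∣M d-1) , (det , ∣-trans (m∣m*n N) c)

  B⊆A : ∀ {x} → B x → A x
  B⊆A {x} (h , t) = H⊆G {x} h , t

  B⊆G : ∀ {x} → B x → G x
  B⊆G {x} (h , _) = H⊆G {x} h

  conj-t-A : ∀ {x} → A x → G (conj-t x)
  conj-t-A {x} ((γ₁ , γ₀) , (_ , 2∣b)) = conj-t-Γ₁ M′ x 2∣b γ₁ , conj-t-Γ₀ (2 ^ r) x 2∣b γ₀

  conj-t-B : ∀ {x} → B x → H (conj-t x)
  conj-t-B {x} (h , (_ , 2∣b)) = conj-t-Γ₁ M x 2∣b h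

  -- conj-t doubles the lower-left entry c; as N is odd, 2^r ∣ c and M ∣ 2c give M ∣ c.
  conj-t⁻¹-H : ∀ {x} → A x → H (conj-t x) → B x
  conj-t⁻¹-H {mat a b c d} (((det , _) , (_ , 2^r∣c)) , γ⁰) (_ , a-1 , M∣2c , d-1) =
    (det , a-1 , M∣c , d-1) , γ⁰
    where
    instance _ = m^n≢0 2 r
    M∣c : + M ∣ℤ c
    M∣c = *odd-∣-2*⇒∣ (2 ^ r) {N} {ν} N≡1+2ν 2^r∣c (subst (M ∣_) (ℤ.abs-* (+ 2) c) M∣2c)

  N-odd′ : + 2 ∣ℤ + N -ℤ + 1
  N-odd′ = Signed.∣⇒∣ᵤ {+ 2} {+ N -ℤ + 1} (Signed.divides (+ ν) N-1≡ν*2)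
    where
    unfold : ∀ ν → + 1 +ℤ ν *ℤ + 2 -ℤ + 1 ≡ ν *ℤ + 2
    unfold = solve-∀
    N-1≡ν*2 : + N -ℤ + 1 ≡ + ν *ℤ + 2
    N-1≡ν*2 = begin
      + N -ℤ + 1                 ≡⟨ cong (λ n → + n -ℤ + 1) N≡1+2ν ⟩
      + (1 + ν * 2) -ℤ + 1       ≡⟨ cong (_-ℤ + 1) (trans (ℤ.pos-+ 1 (ν * 2)) (cong (+ 1 +ℤ_) (ℤ.pos-* ν 2))) ⟩
      + 1 +ℤ + ν *ℤ + 2 -ℤ + 1   ≡⟨ unfold (+ ν) ⟩
      + ν *ℤ + 2                 ∎
      where open ≡-Reasoning

  untwist∈A : ∀ y k → c y ≡ + 2 *ℤ k → G y → + M′ ∣ℤ k → + (2 ^ r) ∣ℤ k → A (untwist y k)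
  untwist∈A y@(mat a b _ d) k c≡2k ((det , M′∣a-1 , _ , M′∣d-1) , _) M′∣k 2^r∣k =
    ((det′ , M′∣a-1 , M′∣k , M′∣d-1) , (det′ , 2^r∣k)) , (det′ , ∣ℤ-*ʳ (+ 2) b (∣-refl {2}))
    where det′ = SL2-untwist y k c≡2k det

  -- yᵢ = xᵢ · shear i lies in xᵢ H and c(yᵢ) = cᵢ (1 + N dᵢ) is even, so yᵢ = conj-t zᵢ with zᵢ ∈ A.
  module Representatives (TV : Transversal G H) where
    x : Fin (n TV) → M2
    x = rep TV

    shear : Fin (n TV) → M2
    shear i = mat (+ 1) (+ 0) (+ N *ℤ c (x i)) (+ 1)

    shear∈H : ∀ i → H (shear i)
    shear∈H i with rep∈ TV i
    ... | (_ , (_ , 2^r∣c)) = det-shear (+ N *ℤ c (x i)) , ∣ℤ-0 M , M∣Nc , ∣ℤ-0 M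
      where
      det-shear : ∀ k → + 1 *ℤ + 1 -ℤ + 0 *ℤ k ≡ + 1
      det-shear = solve-∀
      M∣Nc : + M ∣ℤ + N *ℤ c (x i)
      M∣Nc = subst (M ∣_) (trans (*-comm ∣ c (x i) ∣ N) (sym (ℤ.abs-* (+ N) (c (x i))))) (*-monoˡ-∣ N 2^r∣c)

    TV′ : Transversal G H
    TV′ = shift SG SH (λ {x} → H⊆G {x}) TV shear shear∈H

    y : Fin (n TV) → M2
    y = rep TV′

    1+Nd-even : ∀ i → + 2 ∣ℤ + 1 +ℤ + N *ℤ d (x i)
    1+Nd-even i = 1+odd*odd-even (+ N) (d (x i)) N-odd′ (∣-trans 2∣M′ (proj₂ (proj₂ (proj₂ (proj₁ (rep∈ TV i))))))

    half : Fin (n TV) → ℤ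
    half i = proj₁ (even⇒*2 (+ 1 +ℤ + N *ℤ d (x i)) (1+Nd-even i))

    half-spec : ∀ i → + 1 +ℤ + N *ℤ d (x i) ≡ half i *ℤ + 2
    half-spec i = proj₂ (even⇒*2 (+ 1 +ℤ + N *ℤ d (x i)) (1+Nd-even i))

    c-y : ∀ i → c (y i) ≡ + 2 *ℤ (c (x i) *ℤ half i)
    c-y i = begin
      c (x i) *ℤ + 1 +ℤ d (x i) *ℤ (+ N *ℤ c (x i))  ≡⟨ factor (c (x i)) (d (x i)) (+ N) ⟩
      c (x i) *ℤ (+ 1 +ℤ + N *ℤ d (x i))             ≡⟨ cong (c (x i) *ℤ_) (half-spec i) ⟩
      c (x i) *ℤ (half i *ℤ + 2)                     ≡⟨ regroup (c (x i)) (half i) ⟩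
      + 2 *ℤ (c (x i) *ℤ half i)                     ∎
      where
      open ≡-Reasoning
      factor : ∀ c d n → c *ℤ + 1 +ℤ d *ℤ (n *ℤ c) ≡ c *ℤ (+ 1 +ℤ n *ℤ d)
      factor = solve-∀
      regroup : ∀ c h → c *ℤ (h *ℤ + 2) ≡ + 2 *ℤ (c *ℤ h)
      regroup = solve-∀

    z : Fin (n TV) → M2
    z i = untwist (y i) (c (x i) *ℤ half i)

    conj-t-z : ∀ i → conj-t (z i) ≡ y i
    conj-t-z i = conj-t-untwist (y i) (c (x i) *ℤ half i) (c-y i)

    z∈A : ∀ i → A (z i)
    z∈A i = untwist∈A (y i) (c (x i) *ℤ half i) (c-y i) (rep∈ TV′ i)
      (∣ℤ-*ʳ (c (x i)) (half i) (proj₁ (proj₂ (proj₂ (proj₁ (rep∈ TV i))))))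
      (∣ℤ-*ʳ (c (x i)) (half i) (proj₂ (proj₂ (rep∈ TV i))))

    module TA = Pullback SA (restrict (λ {x} (ax : A x) → proj₂ ax) conj-t-hom)
                        (λ {x} → conj-t-A {x}) (λ {x} → conj-t-B {x}) (λ {x} → conj-t⁻¹-H {x})
                        TV′ z z∈A conj-t-z

  module _ (TV : Transversal G H) (TΦ : Transversal G A) (TΓ : Transversal H B) {g} (pg : G g) where
    open Representatives TV
    private
      module Φt = Transfer SG SA proj₁ TΦ
      module Vt = Transfer SG SH (λ {x} → H⊆G {x}) TV
      module Γt = Transfer SH SB proj₁ TΓ
      module At = Transfer SA SB (λ {x} → B⊆A {x}) TA.pullback
      module C₁ = Composite SG SA SB proj₁ (λ {x} → B⊆A {x}) TΦ TA.pullback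
      module C₂ = Composite SG SH SB (λ {x} → H⊆G {x}) proj₁ TV TΓ
      module C₁t = Transfer SG SB (λ {x} → B⊆G {x}) C₁.composite
      module C₂t = Transfer SG SB (λ {x} → B⊆G {x}) C₂.composite
      module I₁ = TransversalIndependence SG SB (λ {x} → B⊆G {x}) C₂.composite C₁.composite
      module I₂ = TransversalIndependence SG SH (λ {x} → H⊆G {x}) TV′ TV
      module ComB = Commutators SB
      module ComH = Commutators SH

    transferΦ∈A : A (transfer TΦ g)
    transferΦ∈A = Φt.transfer∈ {g} pg

    X Y W₁ W₂ : M2
    X  = transfer TA.pullback (transfer TΦ g)
    Y  = transfer TΓ (transfer TV g)
    W₁ = transfer C₁.composite g
    W₂ = transfer C₂.composite g

    X∈B : B X
    X∈B = At.transfer∈ {transfer TΦ g} transferΦ∈A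

    X~Y : AbEq B X Y
    X~Y = ComB.AbEq-trans {X} {W₁} {Y} (C₁t.transfer∈ {g} pg) (ComB.AbEq-sym {W₁} {X} (C₁.transfer-composite {g} pg))
          (ComB.AbEq-trans {W₁} {W₂} {Y} (C₂t.transfer∈ {g} pg) (I₁.transfer-independent {g} pg) (C₂.transfer-composite {g} pg))

    transfer-atkinU : AbEq H (transfer TV (atkinU TΦ g)) (atkinU TΓ (transfer TV g))
    transfer-atkinU = ComH.AbEq-trans {L} {conj-t X} {R} (conj-t-B {X} X∈B) L~conj-t-X conj-t-X~R
      where
      L R : M2
      L = transfer TV (atkinU TΦ g)
      R = atkinU TΓ (transfer TV g)
      L~L′ : AbEq H L (transfer TV′ (atkinU TΦ g))
      L~L′ = I₂.transfer-independent {atkinU TΦ g} (conj-t-A {transfer TΦ g} transferΦ∈A)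
      L′≡conj-t-X : transfer TV′ (atkinU TΦ g) ≡ conj-t X
      L′≡conj-t-X = trans (cong (transfer TV′) (atkinU-unfold TΦ g)) (sym (TA.φ-transfer {transfer TΦ g} transferΦ∈A))
      L~conj-t-X : AbEq H L (conj-t X)
      L~conj-t-X = subst (AbEq H L) L′≡conj-t-X L~L′
      conj-t-X~conj-t-Y : AbEq H (conj-t X) (conj-t Y)
      conj-t-X~conj-t-Y = AbEq-map SB (restrict (λ {x} (bx : B x) → proj₂ bx) conj-t-hom) (λ {x} → conj-t-B {x}) {X} {Y}
                                   X∈B (Γt.transfer∈ {transfer TV g} (Vt.transfer∈ {g} pg)) X~Y
      conj-t-X~R : AbEq H (conj-t X) R
      conj-t-X~R = subst (AbEq H (conj-t X)) (sym (atkinU-unfold TΓ (transfer TV g))) conj-t-X~conj-t-Y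

lemma3p6 : (N r s : ℕ) → .{{_ : NonZero N}} → ¬ (2 ∣ N) → 2 ≤ s → s ≤ r →
    (TV : Transversal (Φ N r s) (Γ₁ (2 ^ r * N))) →
    (TΦ : Transversal (Φ N r s) (Φ N r s ∩ Γ⁰2)) →
    (TΓ : Transversal (Γ₁ (2 ^ r * N)) (Γ₁ (2 ^ r * N) ∩ Γ⁰2)) →
    (g : M2) → Φ N r s g →
    AbEq (Γ₁ (2 ^ r * N)) (transfer TV (atkinU TΦ g)) (atkinU TΓ (transfer TV g))
lemma3p6 N r s N-odd 2≤s s≤r TV TΦ TΓ g pg = AtkinSetting.transfer-atkinU N r s N-odd 2≤s s≤r TV TΦ TΓ {g} pg
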